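{- Let $r \geq 1$ be an integer, $m_r = 24/\gcd(24,r)$, $b_r = r/\gcd(24,r)$, and $P_r(q) = q^{b_r}\prod_{n\geq1}(1-q^{m_r n})^r \in \mathbb{Z}[[q]]$. Let $\Delta(q) = q\prod_{n\geq1}(1-q^n)^{24}$ and $C(q) = q\prod_{n\geq1}(1-q^{3n})^8$. Then, as $q$-expansions modulo $2$, \[ P_r \equiv \begin{cases} \Delta^{b_r} & \text{if } 3 \mid r,\\ C^{b_r} & \text{otherwise.}\end{cases} \] -}

module Defs where

open import Data.Nat as ℕ using (ℕ; zero; suc; _≡ᵇ_; _∸_)
open import Data.Nat.GCD using (gcd; gcd[m,n]∣m; gcd[m,n]∣n)
open import Data.Nat.Divisibility using (_∣_; _∣?_; quotient)
open import Relation.Nullary using (yes; no)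
open import Data.Integer as ℤ using (ℤ; +_; _-_)
open import Data.Integer.Divisibility as ℤD using ()
open import Data.Bool using (if_then_else_)

Series : Set
Series = ℕ → ℤ

sumTo : ℕ → (ℕ → ℤ) → ℤ
sumTo zero    f = + 0
sumTo (suc n) f = sumTo n f ℤ.+ f n

one : Series
one zero    = + 1
one (suc _) = + 0

qpow : ℕ → Series
qpow k n = if n ≡ᵇ k then + 1 else + 0

_−ₛ_ : Series → Series → Series
(f −ₛ g) n = f n - g n

_*ₛ_ : Series → Series → Series
(f *ₛ g) n = sumTo (suc n) (λ i → f i ℤ.* g (n ∸ i))

_^ₛ_ : Series → ℕ → Series
f ^ₛ zero  = one
f ^ₛ suc k = f *ₛ (f ^ₛ k)

prodTo : ℕ → ℕ → Series
prodTo m zero    = one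
prodTo m (suc K) = prodTo m K *ₛ (one −ₛ qpow (m ℕ.* suc K))

-- the infinite product  ∏_{n≥1} (1 - q^{m n})  (for m ≥ 1): its N-th
-- coefficient equals that of the partial product up to n = N, since the
-- factors with n > N are ≡ 1 mod q^{N+1}.
eulerProd : ℕ → Series
eulerProd m N = prodTo m N N

m-r : ℕ → ℕ
m-r r = quotient (gcd[m,n]∣m 24 r)

b-r : ℕ → ℕ
b-r r = quotient (gcd[m,n]∣n 24 r)

P : ℕ → Series
P r = qpow (b-r r) *ₛ (eulerProd (m-r r) ^ₛ r)

Δ : Series
Δ = qpow 1 *ₛ (eulerProd 1 ^ₛ 24)

C : Series
C = qpow 1 *ₛ (eulerProd 3 ^ₛ 8)

_≡ₛ_mod2 : Series → Series → Set
f ≡ₛ g mod2 = ∀ n → (+ 2) ℤD.∣ (f n - g n)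

target : ℕ → Series
target r with 3 ∣? r
... | yes _ = Δ ^ₛ b-r r
... | no  _ = C ^ₛ b-r r

-- Modulo 2, squaring is additive, so (1 - x)² ≡ 1 - x² and hence
-- ∏(1 - q^(c n))^(2^j) ≡ ∏(1 - q^(2^j c n)).  Since m_r g = 24 and b_r g = r for g = gcd(24, r),
-- m_r is 2^j when 3 ∣ r and 3·2^j otherwise, and m_r r = 24 b_r.  Writing m_r = 2^j c and
-- c e = 24, i.e. (c, e) = (1, 24) or (3, 8), this gives
--   P_r = q^b ∏(1 - q^(2^j c n))^r ≡ q^b ∏(1 - q^(c n))^(2^j r) = (q ∏(1 - q^(c n))^e)^b.
-- The congruences are proved in (ℤ/2)[q]/(q^(N+1)) for every N, where the infinite product
-- agrees with the partial product of its first N factors.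
module Submission where

open import Algebra.Bundles using (CommutativeRing)

module CharacteristicTwo {c ℓ} (R : CommutativeRing c ℓ) where

  open CommutativeRing R
  open import Algebra.Properties.CommutativeSemiring.Exp commutativeSemiring using (_^_; ^-congˡ)
  open import Algebra.Properties.Group +-group using (inverseʳ-unique)
  open import Algebra.Properties.CommutativeSemigroup +-commutativeSemigroup using (interchange)
  open import Relation.Binary.Reasoning.Setoid setoid

  x^2≈x*x : ∀ x → x ^ 2 ≈ x * x
  x^2≈x*x x = *-congˡ (*-identityʳ x)

  module _ (x+x≈0 : ∀ x → x + x ≈ 0#) where

    -x≈x : ∀ x → - x ≈ x
    -x≈x x = sym (inverseʳ-unique x x (x+x≈0 x))

    [x+y]^2≈x^2+y^2 : ∀ x y → (x + y) ^ 2 ≈ x ^ 2 + y ^ 2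
    [x+y]^2≈x^2+y^2 x y = begin
      (x + y) ^ 2                       ≈⟨ x^2≈x*x (x + y) ⟩
      (x + y) * (x + y)                 ≈⟨ distribʳ (x + y) x y ⟩
      x * (x + y) + y * (x + y)         ≈⟨ +-cong (distribˡ x x y) (distribˡ y x y) ⟩
      (x * x + x * y) + (y * x + y * y) ≈⟨ +-congʳ (+-comm (x * x) (x * y)) ⟩
      (x * y + x * x) + (y * x + y * y) ≈⟨ interchange (x * y) (x * x) (y * x) (y * y) ⟩
      (x * y + y * x) + (x * x + y * y) ≈⟨ +-congʳ (+-congˡ (*-comm y x)) ⟩
      (x * y + x * y) + (x * x + y * y) ≈⟨ +-congʳ (x+x≈0 (x * y)) ⟩
      0# + (x * x + y * y)              ≈⟨ +-identityˡ (x * x + y * y) ⟩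
      x * x + y * y                     ≈⟨ +-cong (x^2≈x*x x) (x^2≈x*x y) ⟨
      x ^ 2 + y ^ 2                     ∎

    [1-x]^2≈1-x^2 : ∀ x → (1# - x) ^ 2 ≈ 1# - x ^ 2
    [1-x]^2≈1-x^2 x = begin
      (1# + - x) ^ 2       ≈⟨ [x+y]^2≈x^2+y^2 1# (- x) ⟩
      1# ^ 2 + (- x) ^ 2   ≈⟨ +-cong (trans (x^2≈x*x 1#) (*-identityˡ 1#)) (^-congˡ 2 (-x≈x x)) ⟩
      1# + x ^ 2           ≈⟨ +-congˡ (-x≈x (x ^ 2)) ⟨
      1# - x ^ 2           ∎

open import Data.Integer as ℤ using (ℤ; +_; _+_; _*_; _-_; -_)
import Data.Integer.Divisibility.Signed as ℤ∣
import Data.Integer.Properties as ℤ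
open import Data.Integer.Tactic.RingSolver using (solve-∀)
open import Data.Nat as ℕ using (ℕ; zero; suc; _∸_; _≤_; _<_; s≤s; NonZero)
import Data.Nat.Properties as ℕ
import Data.Nat.Tactic.RingSolver as NatSolver
open import Data.Nat.Divisibility
  using (_∣_; divides; _∣?_; 0∣⇒≡0; >⇒∤; ∣-trans; *-monoʳ-∣; *-cancelʳ-∣; quotient-∣; m∣n⇒n≡quotient*m)
open import Data.Nat.GCD using (gcd; gcd[m,n]∣m; gcd[m,n]∣n; gcd-greatest)
open import Data.Nat.Primality using (prime?; euclidsLemma)
open import Data.Product using (_,_; ∃-syntax; map₂)
open import Data.Sum using (inj₁; inj₂)
open import Relation.Nullary using (¬_; yes; no; contradiction)
open import Relation.Nullary.Decidable using (from-yes; from-no)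
open import Function using (_∘_)
open import Level using (0ℓ)
open import Relation.Binary.PropositionalEquality
  using (_≡_; _≗_; refl; sym; trans; cong; cong₂; subst; module ≡-Reasoning)

open import Defs

sumTo-cong : ∀ n {F G : ℕ → ℤ} → (∀ {i} → i < n → F i ≡ G i) → sumTo n F ≡ sumTo n G
sumTo-cong zero    F≡G = refl
sumTo-cong (suc n) F≡G = cong₂ _+_ (sumTo-cong n (F≡G ∘ ℕ.m<n⇒m<1+n)) (F≡G ℕ.≤-refl)

sumTo-unfoldˡ : ∀ n (F : ℕ → ℤ) → sumTo (suc n) F ≡ F 0 + sumTo n (F ∘ suc)
sumTo-unfoldˡ zero    F = trans (ℤ.+-identityˡ (F 0)) (sym (ℤ.+-identityʳ (F 0)))
sumTo-unfoldˡ (suc n) F = trans (cong (_+ F (suc n)) (sumTo-unfoldˡ n F)) (ℤ.+-assoc (F 0) _ _)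

sumTo-homo-+ : ∀ n (F G : ℕ → ℤ) → sumTo n (λ i → F i + G i) ≡ sumTo n F + sumTo n G
sumTo-homo-+ zero    F G = refl
sumTo-homo-+ (suc n) F G =
  trans (cong (_+ (F n + G n)) (sumTo-homo-+ n F G)) (interchange (sumTo n F) (sumTo n G) (F n) (G n))
  where
  interchange : ∀ a b c d → (a + b) + (c + d) ≡ (a + c) + (b + d)
  interchange = solve-∀

sumTo-distribˡ : ∀ n a (F : ℕ → ℤ) → sumTo n (λ i → a * F i) ≡ a * sumTo n F
sumTo-distribˡ zero    a F = sym (ℤ.*-zeroʳ a)
sumTo-distribˡ (suc n) a F =
  trans (cong (_+ (a * F n)) (sumTo-distribˡ n a F)) (sym (ℤ.*-distribˡ-+ a _ _))

infixl 6 _+ₛ_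

_+ₛ_ : Series → Series → Series
(f +ₛ g) n = f n + g n

-ₛ_ : Series → Series
(-ₛ f) n = - f n

0ₛ : Series
0ₛ _ = + 0

shift : Series → Series
shift f n = f (suc n)

*ₛ-congˡ : ∀ {f f'} g → f ≗ f' → (f *ₛ g) ≗ (f' *ₛ g)
*ₛ-congˡ g f≗f' n = sumTo-cong (suc n) (λ {i} _ → cong (_* g (n ∸ i)) (f≗f' i))

*ₛ-unfold-zero : ∀ f g → (f *ₛ g) 0 ≡ f 0 * g 0
*ₛ-unfold-zero f g = ℤ.+-identityˡ _

*ₛ-unfoldˡ : ∀ f g n → (f *ₛ g) (suc n) ≡ f 0 * g (suc n) + (shift f *ₛ g) n
*ₛ-unfoldˡ f g n = sumTo-unfoldˡ (suc n) (λ i → f i * g (suc n ∸ i))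

*ₛ-unfoldʳ : ∀ f g n → (f *ₛ g) (suc n) ≡ (f *ₛ shift g) n + f (suc n) * g 0
*ₛ-unfoldʳ f g n = cong₂ _+_
  (sumTo-cong (suc n) (λ {i} i≤n → cong (λ k → f i * g k) (ℕ.+-∸-assoc 1 (ℕ.≤-pred i≤n))))
  (cong (λ k → f (suc n) * g k) (ℕ.n∸n≡0 n))

*ₛ-comm : ∀ f g → (f *ₛ g) ≗ (g *ₛ f)
*ₛ-comm f g zero    = trans (*ₛ-unfold-zero f g) (trans (ℤ.*-comm (f 0) (g 0)) (sym (*ₛ-unfold-zero g f)))
*ₛ-comm f g (suc n) = begin
  (f *ₛ g) (suc n)                         ≡⟨ *ₛ-unfoldˡ f g n ⟩
  f 0 * g (suc n) + (shift f *ₛ g) n       ≡⟨ cong₂ _+_ (ℤ.*-comm (f 0) (g (suc n))) (*ₛ-comm (shift f) g n) ⟩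
  g (suc n) * f 0 + (g *ₛ shift f) n       ≡⟨ ℤ.+-comm (g (suc n) * f 0) _ ⟩
  (g *ₛ shift f) n + g (suc n) * f 0       ≡⟨ *ₛ-unfoldʳ g f n ⟨
  (g *ₛ f) (suc n)                         ∎
  where open ≡-Reasoning

*ₛ-distribʳ-+ : ∀ f g h → ((f +ₛ g) *ₛ h) ≗ (f *ₛ h) +ₛ (g *ₛ h)
*ₛ-distribʳ-+ f g h n =
  trans (sumTo-cong (suc n) (λ {i} _ → ℤ.*-distribʳ-+ (h (n ∸ i)) (f i) (g i))) (sumTo-homo-+ (suc n) _ _)

*ₛ-distribˡ-+ : ∀ f g h → (f *ₛ (g +ₛ h)) ≗ (f *ₛ g) +ₛ (f *ₛ h)
*ₛ-distribˡ-+ f g h n = begin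
  (f *ₛ (g +ₛ h)) n            ≡⟨ *ₛ-comm f (g +ₛ h) n ⟩
  ((g +ₛ h) *ₛ f) n            ≡⟨ *ₛ-distribʳ-+ g h f n ⟩
  (g *ₛ f) n + (h *ₛ f) n      ≡⟨ cong₂ _+_ (*ₛ-comm g f n) (*ₛ-comm h f n) ⟩
  (f *ₛ g) n + (f *ₛ h) n      ∎
  where open ≡-Reasoning

*ₛ-scaleˡ : ∀ a f g n → ((λ k → a * f k) *ₛ g) n ≡ a * (f *ₛ g) n
*ₛ-scaleˡ a f g n =
  trans (sumTo-cong (suc n) (λ {i} _ → ℤ.*-assoc a (f i) (g (n ∸ i)))) (sumTo-distribˡ (suc n) a _)

*ₛ-zeroˡ : ∀ f → (0ₛ *ₛ f) ≗ 0ₛ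
*ₛ-zeroˡ f n =
  trans (sumTo-distribˡ (suc n) (+ 0) (λ i → f (n ∸ i))) (ℤ.*-zeroˡ (sumTo (suc n) (λ i → f (n ∸ i))))

*ₛ-identityˡ : ∀ f → (one *ₛ f) ≗ f
*ₛ-identityˡ f zero    = trans (*ₛ-unfold-zero one f) (ℤ.*-identityˡ (f 0))
*ₛ-identityˡ f (suc n) = begin
  (one *ₛ f) (suc n)
    ≡⟨ *ₛ-unfoldˡ one f n ⟩
  + 1 * f (suc n) + (shift one *ₛ f) n
    ≡⟨ cong₂ _+_ (ℤ.*-identityˡ (f (suc n))) (*ₛ-congˡ {shift one} {0ₛ} f (λ _ → refl) n) ⟩
  f (suc n) + (0ₛ *ₛ f) n
    ≡⟨ cong (_+_ (f (suc n))) (*ₛ-zeroˡ f n) ⟩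
  f (suc n) + + 0
    ≡⟨ ℤ.+-identityʳ _ ⟩
  f (suc n) ∎
  where open ≡-Reasoning

*ₛ-identityʳ : ∀ f → (f *ₛ one) ≗ f
*ₛ-identityʳ f n = trans (*ₛ-comm f one n) (*ₛ-identityˡ f n)

*ₛ-assoc : ∀ f g h → ((f *ₛ g) *ₛ h) ≗ (f *ₛ (g *ₛ h))
*ₛ-assoc f g h zero = begin
  ((f *ₛ g) *ₛ h) 0   ≡⟨ *ₛ-unfold-zero (f *ₛ g) h ⟩
  (f *ₛ g) 0 * h 0    ≡⟨ cong (_* h 0) (*ₛ-unfold-zero f g) ⟩
  f 0 * g 0 * h 0     ≡⟨ ℤ.*-assoc (f 0) (g 0) (h 0) ⟩
  f 0 * (g 0 * h 0)   ≡⟨ cong (f 0 *_) (*ₛ-unfold-zero g h) ⟨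
  f 0 * (g *ₛ h) 0    ≡⟨ *ₛ-unfold-zero f (g *ₛ h) ⟨
  (f *ₛ (g *ₛ h)) 0   ∎
  where open ≡-Reasoning
*ₛ-assoc f g h (suc n) = begin
  ((f *ₛ g) *ₛ h) (suc n)
    ≡⟨ *ₛ-unfoldˡ (f *ₛ g) h n ⟩
  (f *ₛ g) 0 * h (suc n) + (shift (f *ₛ g) *ₛ h) n
    ≡⟨ cong₂ _+_ (cong (_* h (suc n)) (*ₛ-unfold-zero f g)) (*ₛ-congˡ h (*ₛ-unfoldˡ f g) n) ⟩
  f 0 * g 0 * h (suc n) + (((λ k → f 0 * g (suc k)) +ₛ (shift f *ₛ g)) *ₛ h) n
    ≡⟨ cong (_+_ (f 0 * g 0 * h (suc n))) (*ₛ-distribʳ-+ (λ k → f 0 * g (suc k)) (shift f *ₛ g) h n) ⟩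
  f 0 * g 0 * h (suc n) + (((λ k → f 0 * g (suc k)) *ₛ h) n + ((shift f *ₛ g) *ₛ h) n)
    ≡⟨ cong (_+_ (f 0 * g 0 * h (suc n))) (cong₂ _+_ (*ₛ-scaleˡ (f 0) (shift g) h n) (*ₛ-assoc (shift f) g h n)) ⟩
  f 0 * g 0 * h (suc n) + (f 0 * (shift g *ₛ h) n + (shift f *ₛ (g *ₛ h)) n)
    ≡⟨ factor (f 0) (g 0) (h (suc n)) _ _ ⟩
  f 0 * (g 0 * h (suc n) + (shift g *ₛ h) n) + (shift f *ₛ (g *ₛ h)) n
    ≡⟨ cong (λ x → f 0 * x + (shift f *ₛ (g *ₛ h)) n) (*ₛ-unfoldˡ g h n) ⟨
  f 0 * (g *ₛ h) (suc n) + (shift f *ₛ (g *ₛ h)) n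
    ≡⟨ *ₛ-unfoldˡ f (g *ₛ h) n ⟨
  (f *ₛ (g *ₛ h)) (suc n) ∎
  where
  open ≡-Reasoning
  factor : ∀ a b c x y → a * b * c + (a * x + y) ≡ a * (b * c + x) + y
  factor = solve-∀

qpow-below : ∀ {t n} → n < t → qpow t n ≡ + 0
qpow-below {suc t} {zero}  _         = refl
qpow-below {suc t} {suc n} (s≤s n<t) = qpow-below n<t

qpow-zero : qpow 0 ≗ one
qpow-zero zero    = refl
qpow-zero (suc _) = refl

qpow-suc : ∀ a → qpow (suc a) ≗ qpow 1 *ₛ qpow a
qpow-suc a zero    = sym (*ₛ-unfold-zero (qpow 1) (qpow a))
qpow-suc a (suc n) = sym (begin
  (qpow 1 *ₛ qpow a) (suc n)                           ≡⟨ *ₛ-unfoldˡ (qpow 1) (qpow a) n ⟩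
  + 0 * qpow a (suc n) + (shift (qpow 1) *ₛ qpow a) n  ≡⟨ ℤ.+-identityˡ _ ⟩
  (shift (qpow 1) *ₛ qpow a) n                          ≡⟨ *ₛ-congˡ (qpow a) shift-qpow-1 n ⟩
  (one *ₛ qpow a) n                                     ≡⟨ *ₛ-identityˡ (qpow a) n ⟩
  qpow a n                                              ∎)
  where
  open ≡-Reasoning
  shift-qpow-1 : shift (qpow 1) ≗ one
  shift-qpow-1 zero    = refl
  shift-qpow-1 (suc _) = refl

*ₛ-[1-qpow]-below : ∀ f {t i} → i < t → (f *ₛ (one −ₛ qpow t)) i ≡ f i
*ₛ-[1-qpow]-below f {t} {i} i<t =
  trans (sumTo-cong (suc i) (λ {j} _ → cong (f j *_) (drop-qpow (i ∸ j) (ℕ.≤-<-trans (ℕ.m∸n≤m i j) i<t))))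
        (*ₛ-identityʳ f i)
  where
  drop-qpow : ∀ k → k < t → one k - qpow t k ≡ one k
  drop-qpow k k<t = trans (cong (λ x → one k - x) (qpow-below k<t)) (ℤ.+-identityʳ (one k))

prodTo-stable : ∀ m .{{_ : NonZero m}} d {i K} → i ≤ K → prodTo m (d ℕ.+ K) i ≡ prodTo m K i
prodTo-stable m zero    i≤K = refl
prodTo-stable m (suc d) {i} {K} i≤K =
  trans (*ₛ-[1-qpow]-below (prodTo m (d ℕ.+ K)) i<t) (prodTo-stable m d i≤K)
  where
  i<t : i < m ℕ.* suc (d ℕ.+ K)
  i<t = ℕ.≤-trans (s≤s (ℕ.≤-trans i≤K (ℕ.m≤n+m K d))) (ℕ.m≤n*m (suc (d ℕ.+ K)) m)

eulerProd-coeff : ∀ m .{{_ : NonZero m}} {i N} → i ≤ N → eulerProd m i ≡ prodTo m N i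
eulerProd-coeff m {i} {N} i≤N =
  trans (sym (prodTo-stable m (N ∸ i) ℕ.≤-refl)) (cong (λ K → prodTo m K i) (ℕ.m∸n+n≡m i≤N))

infix 4 _≡₂_

record _≡₂_ (x y : ℤ) : Set where
  constructor even-difference
  field 2∣x-y : + 2 ℤ∣.∣ x - y

open _≡₂_

private
  via-difference : ∀ {x y u} → u ≡ x - y → + 2 ℤ∣.∣ u → x ≡₂ y
  via-difference u≡x-y 2∣u = even-difference (subst (+ 2 ℤ∣.∣_) u≡x-y 2∣u)

≡₂-reflexive : ∀ {x y} → x ≡ y → x ≡₂ y
≡₂-reflexive {x} refl = even-difference (ℤ∣.divides (+ 0) (ℤ.+-inverseʳ x))

≡₂-sym : ∀ {x y} → x ≡₂ y → y ≡₂ x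
≡₂-sym {x} {y} (even-difference 2∣x-y) = via-difference (negate x y) (ℤ∣.∣m⇒∣-m 2∣x-y)
  where
  negate : ∀ x y → - (x - y) ≡ y - x
  negate = solve-∀

≡₂-trans : ∀ {x y z} → x ≡₂ y → y ≡₂ z → x ≡₂ z
≡₂-trans {x} {y} {z} (even-difference 2∣x-y) (even-difference 2∣y-z) =
  via-difference (telescope x y z) (ℤ∣.∣m∣n⇒∣m+n 2∣x-y 2∣y-z)
  where
  telescope : ∀ x y z → (x - y) + (y - z) ≡ x - z
  telescope = solve-∀

≡₂-+ : ∀ {x x' y y'} → x ≡₂ x' → y ≡₂ y' → x + y ≡₂ x' + y'
≡₂-+ {x} {x'} {y} {y'} (even-difference 2∣x-x') (even-difference 2∣y-y') =
  via-difference (regroup x x' y y') (ℤ∣.∣m∣n⇒∣m+n 2∣x-x' 2∣y-y')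
  where
  regroup : ∀ x x' y y' → (x - x') + (y - y') ≡ (x + y) - (x' + y')
  regroup = solve-∀

≡₂-neg : ∀ {x x'} → x ≡₂ x' → - x ≡₂ - x'
≡₂-neg {x} {x'} (even-difference 2∣x-x') = via-difference (negate x x') (ℤ∣.∣m⇒∣-m 2∣x-x')
  where
  negate : ∀ x x' → - (x - x') ≡ - x - - x'
  negate = solve-∀

≡₂-* : ∀ {x x' y y'} → x ≡₂ x' → y ≡₂ y' → x * y ≡₂ x' * y'
≡₂-* {x} {x'} {y} {y'} (even-difference 2∣x-x') (even-difference 2∣y-y') =
  via-difference (expand x x' y y') (ℤ∣.∣m∣n⇒∣m+n (ℤ∣.∣m⇒∣m*n y 2∣x-x') (ℤ∣.∣n⇒∣m*n x' 2∣y-y'))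
  where
  expand : ∀ x x' y y' → (x - x') * y + x' * (y - y') ≡ x * y - x' * y'
  expand = solve-∀

x+x≡₂0 : ∀ x → x + x ≡₂ + 0
x+x≡₂0 x = via-difference (double x) (ℤ∣.divides x refl)
  where
  double : ∀ x → x * + 2 ≡ x + x - + 0
  double = solve-∀

sumTo-cong₂ : ∀ n {F G : ℕ → ℤ} → (∀ {i} → i < n → F i ≡₂ G i) → sumTo n F ≡₂ sumTo n G
sumTo-cong₂ zero    F≡₂G = ≡₂-reflexive refl
sumTo-cong₂ (suc n) F≡₂G = ≡₂-+ (sumTo-cong₂ n (F≡₂G ∘ ℕ.m<n⇒m<1+n)) (F≡₂G ℕ.≤-refl)

infix 4 _≈[_]_

record _≈[_]_ (f : Series) (N : ℕ) (g : Series) : Set where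
  constructor coefficientwise
  field coefficient : ∀ i → i ≤ N → f i ≡₂ g i

open _≈[_]_

≗⇒≈ : ∀ {N f g} → f ≗ g → f ≈[ N ] g
≗⇒≈ f≗g = coefficientwise (λ i _ → ≡₂-reflexive (f≗g i))

*ₛ-cong : ∀ {N f f' g g'} → f ≈[ N ] f' → g ≈[ N ] g' → f *ₛ g ≈[ N ] f' *ₛ g'
*ₛ-cong (coefficientwise f≡₂f') (coefficientwise g≡₂g') = coefficientwise λ i i≤N →
  sumTo-cong₂ (suc i) (λ {j} j≤i →
    ≡₂-* (f≡₂f' j (ℕ.≤-trans (ℕ.≤-pred j≤i) i≤N)) (g≡₂g' (i ∸ j) (ℕ.≤-trans (ℕ.m∸n≤m i j) i≤N)))

truncatedMod2 : ℕ → CommutativeRing 0ℓ 0ℓ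
truncatedMod2 N = record
  { Carrier = Series
  ; _≈_ = _≈[ N ]_
  ; _+_ = _+ₛ_
  ; _*_ = _*ₛ_
  ; -_ = -ₛ_
  ; 0# = 0ₛ
  ; 1# = one
  ; isCommutativeRing = record
    { isRing = record
      { +-isAbelianGroup = record
        { isGroup = record
          { isMonoid = record
            { isSemigroup = record
              { isMagma = record
                { isEquivalence = record
                  { refl = ≗⇒≈ (λ _ → refl)
                  ; sym = λ (coefficientwise f≡₂g) → coefficientwise λ i i≤N → ≡₂-sym (f≡₂g i i≤N)
                  ; trans = λ (coefficientwise f≡₂g) (coefficientwise g≡₂h) →
                      coefficientwise λ i i≤N → ≡₂-trans (f≡₂g i i≤N) (g≡₂h i i≤N)
                  }
                ; ∙-cong = λ (coefficientwise f≡₂f') (coefficientwise g≡₂g') →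
                  coefficientwise λ i i≤N → ≡₂-+ (f≡₂f' i i≤N) (g≡₂g' i i≤N)
                }
              ; assoc = λ f g h → ≗⇒≈ (λ n → ℤ.+-assoc (f n) (g n) (h n))
              }
            ; identity = (λ f → ≗⇒≈ (ℤ.+-identityˡ ∘ f)) , (λ f → ≗⇒≈ (ℤ.+-identityʳ ∘ f))
            }
          ; inverse = (λ f → ≗⇒≈ (ℤ.+-inverseˡ ∘ f)) , (λ f → ≗⇒≈ (ℤ.+-inverseʳ ∘ f))
          ; ⁻¹-cong = λ (coefficientwise f≡₂g) → coefficientwise λ i i≤N → ≡₂-neg (f≡₂g i i≤N)
          }
        ; comm = λ f g → ≗⇒≈ (λ n → ℤ.+-comm (f n) (g n))
        }
      ; *-cong = *ₛ-cong
      ; *-assoc = λ f g h → ≗⇒≈ (*ₛ-assoc f g h)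
      ; *-identity = (λ f → ≗⇒≈ (*ₛ-identityˡ f)) , (λ f → ≗⇒≈ (*ₛ-identityʳ f))
      ; distrib = (λ f g h → ≗⇒≈ (*ₛ-distribˡ-+ f g h)) , (λ f g h → ≗⇒≈ (*ₛ-distribʳ-+ g h f))
      }
    ; *-comm = λ f g → ≗⇒≈ (*ₛ-comm f g)
    }
  }

24≡m-r*gcd : ∀ r → 24 ≡ m-r r ℕ.* gcd 24 r
24≡m-r*gcd r = m∣n⇒n≡quotient*m (gcd[m,n]∣m 24 r)

m-r*r≡24*b-r : ∀ r → m-r r ℕ.* r ≡ 24 ℕ.* b-r r
m-r*r≡24*b-r r = begin
  m ℕ.* r            ≡⟨ cong (m ℕ.*_) (m∣n⇒n≡quotient*m (gcd[m,n]∣n 24 r)) ⟩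
  m ℕ.* (b ℕ.* g)    ≡⟨ rearrange m b g ⟩
  (m ℕ.* g) ℕ.* b    ≡⟨ cong (ℕ._* b) (24≡m-r*gcd r) ⟨
  24 ℕ.* b           ∎
  where
  open ≡-Reasoning
  m b g : ℕ
  m = m-r r
  b = b-r r
  g = gcd 24 r
  rearrange : ∀ m b g → m ℕ.* (b ℕ.* g) ≡ m ℕ.* g ℕ.* b
  rearrange = NatSolver.solve-∀

2^j*r≡e*b-r : ∀ r c .{{_ : NonZero c}} e j → m-r r ≡ 2 ℕ.^ j ℕ.* c → c ℕ.* e ≡ 24 →
              2 ℕ.^ j ℕ.* r ≡ e ℕ.* b-r r
2^j*r≡e*b-r r c e j m≡2^j*c c*e≡24 = ℕ.*-cancelˡ-≡ _ _ c (begin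
  c ℕ.* (2 ℕ.^ j ℕ.* r)   ≡⟨ ℕ.*-assoc c (2 ℕ.^ j) r ⟨
  c ℕ.* 2 ℕ.^ j ℕ.* r     ≡⟨ cong (ℕ._* r) (ℕ.*-comm c (2 ℕ.^ j)) ⟩
  2 ℕ.^ j ℕ.* c ℕ.* r     ≡⟨ cong (ℕ._* r) m≡2^j*c ⟨
  m-r r ℕ.* r             ≡⟨ m-r*r≡24*b-r r ⟩
  24 ℕ.* b-r r            ≡⟨ cong (ℕ._* b-r r) c*e≡24 ⟨
  c ℕ.* e ℕ.* b-r r       ≡⟨ ℕ.*-assoc c e (b-r r) ⟩
  c ℕ.* (e ℕ.* b-r r)     ∎)
  where open ≡-Reasoning

∣8⇒≡2^ : ∀ {d} → d ∣ 8 → ∃[ j ] d ≡ 2 ℕ.^ j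
∣8⇒≡2^ {0} 0∣8 = contradiction (0∣⇒≡0 0∣8) λ ()
∣8⇒≡2^ {1} _   = 0 , refl
∣8⇒≡2^ {2} _   = 1 , refl
∣8⇒≡2^ {3} 3∣8 = contradiction 3∣8 (from-no (3 ∣? 8))
∣8⇒≡2^ {4} _   = 2 , refl
∣8⇒≡2^ {5} 5∣8 = contradiction 5∣8 (from-no (5 ∣? 8))
∣8⇒≡2^ {6} 6∣8 = contradiction 6∣8 (from-no (6 ∣? 8))
∣8⇒≡2^ {7} 7∣8 = contradiction 7∣8 (from-no (7 ∣? 8))
∣8⇒≡2^ {8} _   = 3 , refl
∣8⇒≡2^ {suc (suc (suc (suc (suc (suc (suc (suc (suc d))))))))} d∣8 = contradiction d∣8 (>⇒∤ (ℕ.m≤m+n 9 d))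

3∣r⇒m-r≡2^j : ∀ r → 3 ∣ r → ∃[ j ] m-r r ≡ 2 ℕ.^ j ℕ.* 1
3∣r⇒m-r≡2^j r 3∣r =
  map₂ (λ m≡2^j → trans m≡2^j (sym (ℕ.*-identityʳ _))) (∣8⇒≡2^ (*-cancelʳ-∣ {n = 8} 3 m*3∣24))
  where
  m*3∣24 : m-r r ℕ.* 3 ∣ 24
  m*3∣24 = subst (m-r r ℕ.* 3 ∣_) (sym (24≡m-r*gcd r)) (*-monoʳ-∣ (m-r r) (gcd-greatest (divides 8 refl) 3∣r))

3∤r⇒m-r≡2^j*3 : ∀ r → ¬ 3 ∣ r → ∃[ j ] m-r r ≡ 2 ℕ.^ j ℕ.* 3
3∤r⇒m-r≡2^j*3 r 3∤r
  with euclidsLemma (m-r r) (gcd 24 r) (from-yes (prime? 3)) (subst (3 ∣_) (24≡m-r*gcd r) (divides 8 refl))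
... | inj₂ 3∣g                 = contradiction (∣-trans 3∣g (gcd[m,n]∣n 24 r)) 3∤r
... | inj₁ (divides k m≡k*3) =
  map₂ (λ k≡2^j → trans m≡k*3 (cong (ℕ._* 3) k≡2^j)) (∣8⇒≡2^ (*-cancelʳ-∣ {k} {8} 3 k*3∣24))
  where
  k*3∣24 : k ℕ.* 3 ∣ 24
  k*3∣24 = subst (_∣ 24) m≡k*3 (quotient-∣ (gcd[m,n]∣m 24 r))

module _ (N : ℕ) where

  open CommutativeRing (truncatedMod2 N)
    using (_≈_; setoid; *-cong; *-congˡ; *-congʳ; +-congˡ; -‿cong; *-identityˡ; *-identityʳ; commutativeSemiring)
    renaming (trans to ≈-trans; reflexive to ≈-reflexive)
  open import Algebra.Properties.CommutativeSemiring.Exp commutativeSemiring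
    using (_^_; ^-congˡ; ^-assocʳ; ^-distrib-*)
  open CharacteristicTwo (truncatedMod2 N) using (x^2≈x*x; [1-x]^2≈1-x^2)
  open import Relation.Binary.Reasoning.Setoid setoid

  x+x≈0 : ∀ f → f +ₛ f ≈ 0ₛ
  x+x≈0 f = coefficientwise λ i _ → x+x≡₂0 (f i)

  ^ₛ≡^ : ∀ f k → f ^ₛ k ≡ f ^ k
  ^ₛ≡^ f zero    = refl
  ^ₛ≡^ f (suc k) = cong (f *ₛ_) (^ₛ≡^ f k)

  qpow≈q^ : ∀ a → qpow a ≈ qpow 1 ^ a
  qpow≈q^ zero    = ≗⇒≈ qpow-zero
  qpow≈q^ (suc a) = ≈-trans (≗⇒≈ (qpow-suc a)) (*-congˡ {qpow 1} (qpow≈q^ a))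

  qpow-^ : ∀ a n → qpow a ^ n ≈ qpow (a ℕ.* n)
  qpow-^ a n = begin
    qpow a ^ n            ≈⟨ ^-congˡ n (qpow≈q^ a) ⟩
    (qpow 1 ^ a) ^ n      ≈⟨ ^-assocʳ (qpow 1) a n ⟩
    qpow 1 ^ (a ℕ.* n)    ≈⟨ qpow≈q^ (a ℕ.* n) ⟨
    qpow (a ℕ.* n)        ∎

  prodTo-^2 : ∀ m K → prodTo m K ^ 2 ≈ prodTo (2 ℕ.* m) K
  prodTo-^2 m zero    = ≈-trans (x^2≈x*x one) (*-identityˡ one)
  prodTo-^2 m (suc K) = begin
    (prodTo m K *ₛ (one −ₛ qpow t)) ^ 2
      ≈⟨ ^-distrib-* (prodTo m K) (one −ₛ qpow t) 2 ⟩
    (prodTo m K ^ 2) *ₛ ((one −ₛ qpow t) ^ 2)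
      ≈⟨ *-cong (prodTo-^2 m K) ([1-x]^2≈1-x^2 x+x≈0 (qpow t)) ⟩
    prodTo (2 ℕ.* m) K *ₛ (one −ₛ (qpow t ^ 2))
      ≈⟨ *-congˡ {prodTo (2 ℕ.* m) K} (+-congˡ {one} (-‿cong (qpow-^ t 2))) ⟩
    prodTo (2 ℕ.* m) K *ₛ (one −ₛ qpow (t ℕ.* 2))
      ≡⟨ cong (λ s → prodTo (2 ℕ.* m) K *ₛ (one −ₛ qpow s)) (t*2 m K) ⟩
    prodTo (2 ℕ.* m) (suc K)
      ∎
    where
    t : ℕ
    t = m ℕ.* suc K
    t*2 : ∀ m K → m ℕ.* suc K ℕ.* 2 ≡ 2 ℕ.* m ℕ.* suc K
    t*2 = NatSolver.solve-∀

  prodTo-^2^j : ∀ j m K → prodTo m K ^ (2 ℕ.^ j) ≈ prodTo (2 ℕ.^ j ℕ.* m) K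
  prodTo-^2^j zero    m K =
    ≈-trans (*-identityʳ (prodTo m K)) (≈-reflexive (cong (λ s → prodTo s K) (sym (ℕ.*-identityˡ m))))
  prodTo-^2^j (suc j) m K = begin
    prodTo m K ^ (2 ℕ.* 2 ℕ.^ j)            ≈⟨ ^-assocʳ (prodTo m K) 2 (2 ℕ.^ j) ⟨
    (prodTo m K ^ 2) ^ (2 ℕ.^ j)            ≈⟨ ^-congˡ (2 ℕ.^ j) (prodTo-^2 m K) ⟩
    prodTo (2 ℕ.* m) K ^ (2 ℕ.^ j)          ≈⟨ prodTo-^2^j j (2 ℕ.* m) K ⟩
    prodTo (2 ℕ.^ j ℕ.* (2 ℕ.* m)) K        ≡⟨ cong (λ s → prodTo s K) (regroup (2 ℕ.^ j) m) ⟩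
    prodTo (2 ℕ.^ suc j ℕ.* m) K            ∎
    where
    regroup : ∀ p m → p ℕ.* (2 ℕ.* m) ≡ 2 ℕ.* p ℕ.* m
    regroup = NatSolver.solve-∀

  eulerProd≈prodTo : ∀ m .{{_ : NonZero m}} → eulerProd m ≈ prodTo m N
  eulerProd≈prodTo m = coefficientwise λ i i≤N → ≡₂-reflexive (eulerProd-coeff m i≤N)

  eulerProd-^2^j : ∀ j c .{{_ : NonZero c}} → eulerProd c ^ (2 ℕ.^ j) ≈ eulerProd (2 ℕ.^ j ℕ.* c)
  eulerProd-^2^j j c = begin
    eulerProd c ^ (2 ℕ.^ j)          ≈⟨ ^-congˡ (2 ℕ.^ j) (eulerProd≈prodTo c) ⟩
    prodTo c N ^ (2 ℕ.^ j)           ≈⟨ prodTo-^2^j j c N ⟩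
    prodTo (2 ℕ.^ j ℕ.* c) N         ≈⟨ eulerProd≈prodTo (2 ℕ.^ j ℕ.* c) {{ℕ.m*n≢0 (2 ℕ.^ j) c {{ℕ.m^n≢0 2 j}}}} ⟨
    eulerProd (2 ℕ.^ j ℕ.* c)        ∎

  P≈[q*eulerProd[c]^e]^b : ∀ r c .{{_ : NonZero c}} e j → m-r r ≡ 2 ℕ.^ j ℕ.* c → c ℕ.* e ≡ 24 →
                           P r ≈ (qpow 1 *ₛ (eulerProd c ^ₛ e)) ^ₛ b-r r
  P≈[q*eulerProd[c]^e]^b r c e j m≡2^j*c c*e≡24 = begin
    qpow b *ₛ (eulerProd (m-r r) ^ₛ r)
      ≡⟨ cong (λ m → qpow b *ₛ (eulerProd m ^ₛ r)) m≡2^j*c ⟩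
    qpow b *ₛ (eulerProd (2 ℕ.^ j ℕ.* c) ^ₛ r)
      ≡⟨ cong (qpow b *ₛ_) (^ₛ≡^ (eulerProd (2 ℕ.^ j ℕ.* c)) r) ⟩
    qpow b *ₛ (eulerProd (2 ℕ.^ j ℕ.* c) ^ r)
      ≈⟨ *-congˡ {qpow b} (^-congˡ r (eulerProd-^2^j j c)) ⟨
    qpow b *ₛ ((eulerProd c ^ (2 ℕ.^ j)) ^ r)
      ≈⟨ *-congˡ {qpow b} (^-assocʳ (eulerProd c) (2 ℕ.^ j) r) ⟩
    qpow b *ₛ (eulerProd c ^ (2 ℕ.^ j ℕ.* r))
      ≡⟨ cong (λ n → qpow b *ₛ (eulerProd c ^ n)) (2^j*r≡e*b-r r c e j m≡2^j*c c*e≡24) ⟩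
    qpow b *ₛ (eulerProd c ^ (e ℕ.* b))
      ≈⟨ *-congˡ {qpow b} (^-assocʳ (eulerProd c) e b) ⟨
    qpow b *ₛ ((eulerProd c ^ e) ^ b)
      ≈⟨ *-congʳ {(eulerProd c ^ e) ^ b} (qpow≈q^ b) ⟩
    (qpow 1 ^ b) *ₛ ((eulerProd c ^ e) ^ b)
      ≈⟨ ^-distrib-* (qpow 1) (eulerProd c ^ e) b ⟨
    (qpow 1 *ₛ (eulerProd c ^ e)) ^ b
      ≡⟨ cong (λ g → (qpow 1 *ₛ g) ^ b) (^ₛ≡^ (eulerProd c) e) ⟨
    (qpow 1 *ₛ (eulerProd c ^ₛ e)) ^ b
      ≡⟨ ^ₛ≡^ (qpow 1 *ₛ (eulerProd c ^ₛ e)) b ⟨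
    (qpow 1 *ₛ (eulerProd c ^ₛ e)) ^ₛ b
      ∎
    where
    b : ℕ
    b = b-r r

P≈target : ∀ r N → P r ≈[ N ] target r
P≈target r N with 3 ∣? r
... | yes 3∣r = let j , m≡2^j   = 3∣r⇒m-r≡2^j r 3∣r   in P≈[q*eulerProd[c]^e]^b N r 1 24 j m≡2^j refl
... | no  3∤r = let j , m≡2^j*3 = 3∤r⇒m-r≡2^j*3 r 3∤r in P≈[q*eulerProd[c]^e]^b N r 3 8 j m≡2^j*3 refl

proposition2p4 : (r : ℕ) → 1 ≤ r → P r ≡ₛ target r mod2
proposition2p4 r _ n = ℤ∣.∣⇒∣ᵤ (2∣x-y (coefficient (P≈target r n) n ℕ.≤-refl))
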